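{- Let $\mathbb{X} = (X, \wedge, \top, \tau)$ be an M-space and let $c \subseteq X$ be a filter of the semilattice $(X, \wedge, \top)$. Then $c$ is closed in $(X,\tau)$ if and only if $c$ is the intersection of all clopen filters of $\mathbb{X}$ that contain $c$.
   Context: A (meet-)semilattice $(X,\wedge,\top)$ is a poset with finite meets; a filter is a non-empty up-closed subset closed under finite meets. An M-space is a tuple $(X,\wedge,\top,\tau)$ such that $(X,\wedge,\top)$ is a meet-semilattice with top and $(X,\tau)$ is a Stone space (compact, Hausdorff, zero-dimensional) whose topology is generated by a subbase consisting of clopen filters and complements of clopen filters. -}

module Defs where

open import Level using (0ℓ) renaming (suc to lsuc)
open import Data.Product using (Σ; ∃; _×_; _,_)
open import Data.Sum using (_⊎_)
open import Data.List using (List)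
open import Data.Unit using () renaming (⊤ to Unit)
open import Data.List.Relation.Unary.All using (All)
open import Data.List.Relation.Unary.Any using (Any)
open import Relation.Nullary using (¬_)
open import Relation.Unary using (Pred; _∈_; _⊆_; ∁; _∩_; Empty)
open import Relation.Binary.Lattice.Bundles using (BoundedMeetSemilattice)

Subset : Set → Set₁
Subset X = Pred X 0ℓ

⋂ : {X : Set} → Pred (Subset X) (lsuc 0ℓ) → Pred X (lsuc 0ℓ)
⋂ {X} 𝓕 x = (F : Subset X) → 𝓕 F → x ∈ F

InAll : {X : Set} → List (Subset X) → Pred X (lsuc 0ℓ)
InAll Us x = All (λ U → x ∈ U) Us

record TopologicalSpace (X : Set) : Set₂ where
  field
    IsOpen      : Pred (Subset X) (lsuc 0ℓ)
    open-whole  : IsOpen (λ _ → Unit)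
    open-∩      : ∀ {U V} → IsOpen U → IsOpen V → IsOpen (U ∩ V)
    open-⋃      : (I : Set) (U : I → Subset X) → (∀ i → IsOpen (U i)) →
                  IsOpen (λ x → Σ I (λ i → x ∈ U i))
    open-ext    : ∀ {U V} → U ⊆ V → V ⊆ U → IsOpen U → IsOpen V
  IsClosed : Pred (Subset X) (lsuc 0ℓ)
  IsClosed C = IsOpen (∁ C)
  IsClopen : Pred (Subset X) (lsuc 0ℓ)
  IsClopen U = IsOpen U × IsClosed U


module _ {X : Set} (τ : TopologicalSpace X) where
  open TopologicalSpace τ

  IsCompact : Set₁
  IsCompact = (I : Set) (U : I → Subset X) → (∀ i → IsOpen (U i)) →
              (∀ x → Σ I (λ i → x ∈ U i)) →
              Σ (List I) (λ is → ∀ x → Any (λ i → x ∈ U i) is)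

  IsHausdorff : (_≈_ : X → X → Set) → Set₁
  IsHausdorff _≈_ = ∀ x y → ¬ (x ≈ y) →
    Σ (Subset X) λ U → Σ (Subset X) λ V →
      IsOpen U × IsOpen V × x ∈ U × y ∈ V × Empty (U ∩ V)

  IsZeroDimensional : Set₁
  IsZeroDimensional = ∀ U x → IsOpen U → x ∈ U →
    Σ (Subset X) λ V → IsClopen V × x ∈ V × V ⊆ U

  IsStone : (_≈_ : X → X → Set) → Set₁
  IsStone _≈_ = IsCompact × IsHausdorff _≈_ × IsZeroDimensional

  GeneratedBy : Pred (Subset X) 0ℓ → Set₁
  GeneratedBy S = ∀ U →
    (IsOpen U → (∀ x → x ∈ U → Σ (List (Subset X)) λ Bs →
        All S Bs × x ∈ InAll Bs × InAll Bs ⊆ U))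
    × ((∀ x → x ∈ U → Σ (List (Subset X)) λ Bs →
        All S Bs × x ∈ InAll Bs × InAll Bs ⊆ U) → IsOpen U)

module _ (L : BoundedMeetSemilattice 0ℓ 0ℓ 0ℓ) where
  open BoundedMeetSemilattice L

  IsFilter : Subset Carrier → Set
  IsFilter F = Σ Carrier (λ x → x ∈ F)
             × (∀ {x y} → x ∈ F → x ≤ y → y ∈ F)
             × (∀ {x y} → x ∈ F → y ∈ F → (x ∧ y) ∈ F)

record MSpace : Set₃ where
  field
    semilattice : BoundedMeetSemilattice 0ℓ 0ℓ 0ℓ
  open BoundedMeetSemilattice semilattice public
  field
    topology : TopologicalSpace Carrier
  open TopologicalSpace topology public
  IsClopenFilter : Subset Carrier → Set₁
  IsClopenFilter F = IsClopen F × IsFilter semilattice F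
  field
    stone    : IsStone topology _≈_
    subbase  : Pred (Subset Carrier) 0ℓ
    subbase-gen : GeneratedBy topology subbase
    subbase-spec : ∀ S → subbase S →
      Σ (Subset Carrier) λ F → IsClopenFilter F ×
        ((S ⊆ F × F ⊆ S) ⊎ (S ⊆ ∁ F × ∁ F ⊆ S))

-- Clopen filters separate the order: if y ≰ x, then y ≠ x ∧ y, so by
-- Hausdorffness some subbasic set contains y but not x ∧ y; it must be a
-- clopen filter F (a complement of a filter cannot contain y and miss the
-- smaller x ∧ y), and x ∉ F because F is closed under meets.  For x ∉ c the
-- filters F_y (y ∈ c) with x ∉ F_y, together with the complement of c, cover
-- the space; by compactness finitely many do, and a filter covered by finitely
-- many up-sets lies inside one of them.  Conversely an intersection of clopen
-- sets is closed.

module Submission where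

open import Defs
open import Level using (0ℓ; lift; lower) renaming (suc to lsuc)
open import Data.Product using (Σ; ∃; _×_; _,_; proj₁; proj₂)
open import Data.Sum using (_⊎_; inj₁; inj₂)
open import Data.Unit using (tt) renaming (⊤ to Unit)
open import Data.Empty using (⊥-elim)
open import Data.List using (List; []; _∷_)
open import Data.List.Relation.Unary.All using (All; lookupAny; zip)
open import Data.List.Relation.Unary.All.Properties using (¬All⇒Any¬)
open import Data.List.Relation.Unary.Any as Any using (Any; here; there; satisfied)
open import Function using (_∘_)
open import Function.Bundles using (_⇔_; mk⇔)
open import Relation.Nullary using (¬_; yes; no)
open import Relation.Nullary.Decidable using (map′)
open import Relation.Unary using (Pred; _∈_; _∉_; _⊆_; _≐_; ∁; _∩_)
open import Relation.Binary.Lattice.Bundles using (BoundedMeetSemilattice)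
open import Axiom.ExcludedMiddle using (ExcludedMiddle)
open import Axiom.DoubleNegationElimination using (DoubleNegationElimination; em⇒dne)

module _ {X : Set} (τ : TopologicalSpace X) where
  open TopologicalSpace τ

  hausdorff⇒T₁ : {_≈_ : X → X → Set} → IsHausdorff τ _≈_ →
                 ∀ {x y} → ¬ (x ≈ y) → Σ (Subset X) λ U → IsOpen U × x ∈ U × y ∉ U
  hausdorff⇒T₁ haus {x} {y} x≉y with haus x y x≉y
  ... | U , V , oU , _ , x∈U , y∈V , U∩V≡∅ = U , oU , x∈U , λ y∈U → U∩V≡∅ y (y∈U , y∈V)

  -- open-⋃ only admits small index sets, so unions indexed by subsets of X
  -- have to go through the subbase.
  module _ {S : Pred (Subset X) 0ℓ} (gen : GeneratedBy τ S) where

    open-if-locally-open : (U : Subset X) →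
      (∀ {x} → x ∈ U → Σ (Subset X) λ V → IsOpen V × x ∈ V × V ⊆ U) → IsOpen U
    open-if-locally-open U nbhd = proj₂ (gen U) basic
      where
      basic : ∀ x → x ∈ U → Σ (List (Subset X)) λ Bs → All S Bs × x ∈ InAll Bs × InAll Bs ⊆ U
      basic x x∈U with nbhd x∈U
      ... | V , oV , x∈V , V⊆U with proj₁ (gen V) oV x x∈V
      ...   | Bs , sBs , x∈Bs , Bs⊆V = Bs , sBs , x∈Bs , V⊆U ∘ Bs⊆V

    closed-if-separated-by-closed : (C : Subset X) →
      (∀ {x} → x ∉ C → Σ (Subset X) λ F → IsClosed F × C ⊆ F × x ∉ F) → IsClosed C
    closed-if-separated-by-closed C sep = open-if-locally-open (∁ C) nbhd
      where
      nbhd : ∀ {x} → x ∉ C → Σ (Subset X) λ V → IsOpen V × x ∈ V × V ⊆ ∁ C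
      nbhd x∉C with sep x∉C
      ... | F , cF , C⊆F , x∉F = ∁ F , cF , x∉F , λ z∉F z∈C → z∉F (C⊆F z∈C)

module _ (L : BoundedMeetSemilattice 0ℓ 0ℓ 0ℓ) where
  open BoundedMeetSemilattice L

  UpClosed : Subset Carrier → Set
  UpClosed F = ∀ {x y} → x ∈ F → x ≤ y → y ∈ F

  ∩-upClosed : {F G : Subset Carrier} → UpClosed F → UpClosed G → UpClosed (F ∩ G)
  ∩-upClosed upF upG (x∈F , x∈G) x≤y = upF x∈F x≤y , upG x∈G x≤y

module Classical (em : ExcludedMiddle (lsuc 0ℓ)) where

  em₀ : ExcludedMiddle 0ℓ
  em₀ = map′ lower lift em

  dne₀ : DoubleNegationElimination 0ℓ
  dne₀ = em⇒dne em₀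

  dne₁ : DoubleNegationElimination (lsuc 0ℓ)
  dne₁ = em⇒dne em

  ¬⊆⇒∃∉ : {X : Set} {A B : Subset X} → ¬ (A ⊆ B) → ∃ λ x → x ∈ A × x ∉ B
  ¬⊆⇒∃∉ A⊈B = dne₀ λ ¬∃ → A⊈B λ {x} x∈A → dne₀ λ x∉B → ¬∃ (x , x∈A , x∉B)

  ∉⋂⇒∃∉ : {X : Set} {𝓕 : Pred (Subset X) (lsuc 0ℓ)} {x : X} →
          x ∉ ⋂ 𝓕 → Σ (Subset X) λ F → 𝓕 F × x ∉ F
  ∉⋂⇒∃∉ x∉⋂ = dne₁ λ ¬∃ → x∉⋂ λ F F∈𝓕 → dne₀ λ x∉F → ¬∃ (F , F∈𝓕 , x∉F)

  module _ (L : BoundedMeetSemilattice 0ℓ 0ℓ 0ℓ) where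
    open BoundedMeetSemilattice L

    -- If c ⊈ U i, a witness h ∈ c ∖ U i pushes every z ∈ c to z ∧ h, which must
    -- lie in another member of the cover; up-closure brings z back there.
    filter⊆finite-cover-member : {c : Subset Carrier} → IsFilter L c →
      {I : Set} (U : I → Subset Carrier) → (∀ i → UpClosed L (c ∩ U i)) →
      (is : List I) → c ⊆ (λ z → Any (λ i → z ∈ U i) is) → Any (λ i → c ⊆ U i) is
    filter⊆finite-cover-member ((t , t∈c) , _) U up [] cov with cov t∈c
    ... | ()
    filter⊆finite-cover-member {c} fc@(_ , _ , ∧-closed) U up (i ∷ is) cov
      with em₀ {c ⊆ U i}
    ... | yes c⊆Ui = here c⊆Ui
    ... | no c⊈Ui with ¬⊆⇒∃∉ c⊈Ui
    ...   | h , h∈c , h∉Ui = there (filter⊆finite-cover-member fc U up is cov′)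
      where
      cov′ : c ⊆ (λ z → Any (λ j → z ∈ U j) is)
      cov′ {z} z∈c with cov (∧-closed z∈c h∈c)
      ... | here z∧h∈Ui = ⊥-elim (h∉Ui (proj₂ (up i (∧-closed z∈c h∈c , z∧h∈Ui) (x∧y≤y z h))))
      ... | there z∧h∈⋃ =
            Any.map (λ {j} z∧h∈Uj → proj₂ (up j (∧-closed z∈c h∈c , z∧h∈Uj) (x∧y≤x z h))) z∧h∈⋃

  module _ (𝕏 : MSpace) where
    open MSpace 𝕏

    subbasic-separating : ∀ {y m} → ¬ (y ≈ m) →
      Σ (Subset Carrier) λ B → subbase B × y ∈ B × m ∉ B
    subbasic-separating {y} {m} y≉m with hausdorff⇒T₁ topology (proj₁ (proj₂ stone)) y≉m
    ... | U , oU , y∈U , m∉U with proj₁ (subbase-gen U) oU y y∈U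
    ...   | Bs , sBs , y∈Bs , Bs⊆U with ¬All⇒Any¬ (λ _ → em₀) Bs (m∉U ∘ Bs⊆U)
    ...     | m∉some with lookupAny (zip (sBs , y∈Bs)) m∉some
    ...       | (sB , y∈B) , m∉B = Any.lookup m∉some , sB , y∈B , m∉B

    -- A complement of a filter containing y would contain every m ≤ y.
    subbasic-separating-below⇒clopenFilter : ∀ {B y m} → subbase B → y ∈ B → m ∉ B → m ≤ y →
      Σ (Subset Carrier) λ F → IsClopenFilter F × y ∈ F × m ∉ F
    subbasic-separating-below⇒clopenFilter {B} sB y∈B m∉B m≤y with subbase-spec B sB
    ... | F , cf , inj₁ (B⊆F , F⊆B) = F , cf , B⊆F y∈B , m∉B ∘ F⊆B
    ... | F , cf@(_ , _ , upF , _) , inj₂ (B⊆∁F , ∁F⊆B) =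
          ⊥-elim (B⊆∁F y∈B (upF (dne₀ (m∉B ∘ ∁F⊆B)) m≤y))

    clopenFilters-separate-order : ∀ {x y} → ¬ (y ≤ x) →
      Σ (Subset Carrier) λ F → IsClopenFilter F × y ∈ F × x ∉ F
    clopenFilters-separate-order {x} {y} y≰x
      with subbasic-separating {y} {x ∧ y} (λ y≈x∧y → y≰x (trans (reflexive y≈x∧y) (x∧y≤x x y)))
    ... | B , sB , y∈B , x∧y∉B
      with subbasic-separating-below⇒clopenFilter sB y∈B x∧y∉B (x∧y≤y x y)
    ...   | F , cf@(_ , _ , _ , ∧-closed) , y∈F , x∧y∉F =
            F , cf , y∈F , λ x∈F → x∧y∉F (∧-closed x∈F y∈F)

    -- Compactness turns separation of x from each point of a closed filter c
    -- into separation of x from c.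
    pointwise⇒filter-separation : ∀ {c x} → IsFilter semilattice c → IsClosed c →
      (∀ {y} → y ∈ c → Σ (Subset Carrier) λ F → IsClopenFilter F × y ∈ F × x ∉ F) →
      Σ (Subset Carrier) λ F → IsClopenFilter F × c ⊆ F × x ∉ F
    pointwise⇒filter-separation {c} {x} fc@((t , t∈c) , upc , _) cl separate =
      pick (satisfied (filter⊆finite-cover-member semilattice fc U up-c∩U subcover covers-c))
      where
      I : Set
      I = (∃ λ y → y ∈ c) ⊎ Unit

      U : I → Subset Carrier
      U (inj₁ (_ , y∈c)) = proj₁ (separate y∈c)
      U (inj₂ _)         = ∁ c

      open-U : ∀ i → IsOpen (U i)
      open-U (inj₁ (_ , y∈c)) with separate y∈c
      ... | _ , ((oF , _) , _) , _ = oF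
      open-U (inj₂ _) = cl

      up-c∩U : ∀ i → UpClosed semilattice (c ∩ U i)
      up-c∩U (inj₁ (_ , y∈c)) with separate y∈c
      ... | _ , (_ , _ , upF , _) , _ = ∩-upClosed semilattice upc upF
      up-c∩U (inj₂ _) (z∈c , z∉c) _ = ⊥-elim (z∉c z∈c)

      covers-X : ∀ z → Σ I λ i → z ∈ U i
      covers-X z with em₀ {z ∈ c}
      ... | yes z∈c = inj₁ (z , z∈c) , proj₁ (proj₂ (proj₂ (separate z∈c)))
      ... | no z∉c  = inj₂ tt , z∉c

      subcover : List I
      subcover = proj₁ (proj₁ stone I U open-U covers-X)

      covers-c : c ⊆ (λ z → Any (λ i → z ∈ U i) subcover)
      covers-c {z} _ = proj₂ (proj₁ stone I U open-U covers-X) z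

      pick : (Σ I λ i → c ⊆ U i) → Σ (Subset Carrier) λ F → IsClopenFilter F × c ⊆ F × x ∉ F
      pick (inj₁ (_ , y∈c) , c⊆F) with separate y∈c
      ... | F , cf , _ , x∉F = F , cf , c⊆F , x∉F
      pick (inj₂ _ , c⊆∁c) = ⊥-elim (c⊆∁c t∈c t∈c)

    closed-filter-separation : ∀ {c x} → IsFilter semilattice c → IsClosed c → x ∉ c →
      Σ (Subset Carrier) λ F → IsClopenFilter F × c ⊆ F × x ∉ F
    closed-filter-separation fc@(_ , upc , _) cl x∉c =
      pointwise⇒filter-separation fc cl λ y∈c → clopenFilters-separate-order (x∉c ∘ upc y∈c)

lemma2p2 : ExcludedMiddle (lsuc 0ℓ) →
    (𝕏 : MSpace) (c : Subset (MSpace.Carrier 𝕏)) →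
    IsFilter (MSpace.semilattice 𝕏) c →
    MSpace.IsClosed 𝕏 c ⇔ (c ≐ ⋂ (λ F → c ⊆ F × MSpace.IsClopenFilter 𝕏 F))
lemma2p2 em 𝕏 c fc = mk⇔ equal closed
  where
  open Classical em
  open MSpace 𝕏

  equal : IsClosed c → c ≐ ⋂ (λ F → c ⊆ F × IsClopenFilter F)
  equal cl = (λ z∈c _ (c⊆F , _) → c⊆F z∈c) , λ {x} x∈⋂ → dne₀ λ x∉c →
    let F , cf , c⊆F , x∉F = closed-filter-separation 𝕏 fc cl x∉c in x∉F (x∈⋂ F (c⊆F , cf))

  closed : c ≐ ⋂ (λ F → c ⊆ F × IsClopenFilter F) → IsClosed c
  closed (_ , ⋂⊆c) = closed-if-separated-by-closed topology subbase-gen c separate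
    where
    separate : ∀ {x} → x ∉ c → Σ (Subset Carrier) λ F → IsClosed F × c ⊆ F × x ∉ F
    separate x∉c with ∉⋂⇒∃∉ (x∉c ∘ ⋂⊆c)
    ... | F , (c⊆F , (_ , cF) , _) , x∉F = F , cF , c⊆F , x∉F
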